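{- Maehara interpolation in $\mathbf{LK}^{\mathrm{at}}$ is complete: for every valid implication $A\to B$ and every interpolant $C$ of $A\to B$ there is an $\mathbf{LK}^{\mathrm{at}}$ proof $\pi$ of the split sequent $A;\Rightarrow;B$ such that $\mathcal{M}(\pi)$ is logically equivalent to $C$.
   Context: Propositional formulas are built from atoms and $\bot$ using $\wedge,\vee,\neg$; $A\to B$ abbreviates $\neg A\vee B$; $\top$ abbreviates $\bot\to\bot$. $V(A)$ is the set of atoms of $A$ (extended to multisets by union). An interpolant of a valid $A\to B$ is a formula $C$ with $V(C)\subseteq V(A)\cap V(B)$ such that $A\to C$ and $C\to B$ are valid. $\mathbf{LK}$ is the sequent calculus (sequents $\Gamma\Rightarrow\Delta$ of finite multisets) with axioms $p\Rightarrow p$ ($p$ an atom) and $\bot\Rightarrow$, and rules: weakening and contraction on both sides; $(L\wedge_1)$: $A,\Gamma\Rightarrow\Delta$ / $A\wedge B,\Gamma\Rightarrow\Delta$; $(L\wedge_2)$: $B,\Gamma\Rightarrow\Delta$ / $A\wedge B,\Gamma\Rightarrow\Delta$; $(R\wedge)$: $\Gamma\Rightarrow\Delta,A$ and $\Gamma\Rightarrow\Delta,B$ / $\Gamma\Rightarrow\Delta,A\wedge B$; $(R\vee_1)$, $(R\vee_2)$: $\Gamma\Rightarrow\Delta,A$ (resp. $B$) / $\Gamma\Rightarrow\Delta,A\vee B$; $(L\vee)$: $A,\Gamma\Rightarrow\Delta$ and $B,\Gamma\Rightarrow\Delta$ / $A\vee B,\Gamma\Rightarrow\Delta$; $(L\neg)$: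 $\Gamma\Rightarrow\Delta,A$ / $\neg A,\Gamma\Rightarrow\Delta$; $(R\neg)$: $A,\Gamma\Rightarrow\Delta$ / $\Gamma\Rightarrow\Delta,\neg A$; cut: $\Gamma\Rightarrow\Delta,A$ and $A,\Gamma\Rightarrow\Delta$ / $\Gamma\Rightarrow\Delta$. $\mathbf{LK}^{\mathrm{at}}$ allows only cuts whose cut formula is an atom, $\bot$ or $\top$. A split sequent $\Gamma_1;\Gamma_2\Rightarrow\Delta_1;\Delta_2$ is the sequent $\Gamma_1,\Gamma_2\Rightarrow\Delta_1,\Delta_2$ with formulas divided into a left side ($\Gamma_1,\Delta_1$) and a right side ($\Gamma_2,\Delta_2$). In a proof of a split sequent every sequent is split, context formulas keep their side, auxiliary formulas lie on the side of the main formula, and for a cut with conclusion $\Gamma_1;\Gamma_2\Rightarrow\Delta_1;\Delta_2$ and cut formula $A$ both occurrences of $A$ lie on the left side (allowed only if $V(A)\subseteq V(\Gamma_1\cup\Delta_1)$) or both on the right side (allowed only if $V(A)\subseteq V(\Gamma_2\cup\Delta_2)$). The Maehara interpolant $\mathcal{M}(\pi)$: axioms $p;\Rightarrow p;$ give $\bot$, $;p\Rightarrow;p$ give $\top$, $p;\Rightarrow;p$ give $p$, $;p\Rightarrow p;$ give $\neg p$, $\bot;\Rightarrow;$ gives $\bot$, $;\bot\Rightarrow;$ gives $\top$; unary rules keep the premise's interpolant; a binary rule ($(R\wedge)$, $(L\vee)$, cut) with premise proofs $\pi_1,\pi_2$ gives $\mathcal{M}(\pi_1)\vee\mathcal{M}(\pi_2)$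 if its main/cut formula is on the left side and $\mathcal{M}(\pi_1)\wedge\mathcal{M}(\pi_2)$ if on the right side. -}

module Defs where

open import Data.Nat using (ℕ)
open import Data.Bool using (Bool; true; false; _∧_; _∨_; not)
open import Data.List using (List; []; _∷_; _++_)
open import Data.List.Relation.Unary.Any using (Any)
open import Data.List.Relation.Binary.Permutation.Propositional using (_↭_)
open import Data.Product using (_×_; _,_)
open import Relation.Binary.PropositionalEquality using (_≡_)

infixr 6 _∧ᶠ_
infixr 5 _∨ᶠ_
infixr 4 _⇒ᶠ_

data Formula : Set where
  atom  : ℕ → Formula
  ⊥ᶠ    : Formula
  _∧ᶠ_  : Formula → Formula → Formula
  _∨ᶠ_  : Formula → Formula → Formula
  ¬ᶠ_   : Formula → Formula

_⇒ᶠ_ : Formula → Formula → Formula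
A ⇒ᶠ B = (¬ᶠ A) ∨ᶠ B

⊤ᶠ : Formula
⊤ᶠ = ⊥ᶠ ⇒ᶠ ⊥ᶠ

Valuation : Set
Valuation = ℕ → Bool

eval : Valuation → Formula → Bool
eval v (atom p) = v p
eval v ⊥ᶠ       = false
eval v (A ∧ᶠ B) = eval v A ∧ eval v B
eval v (A ∨ᶠ B) = eval v A ∨ eval v B
eval v (¬ᶠ A)   = not (eval v A)

Valid : Formula → Set
Valid A = ∀ (v : Valuation) → eval v A ≡ true

_≈ᶠ_ : Formula → Formula → Set
A ≈ᶠ B = ∀ (v : Valuation) → eval v A ≡ eval v B

data _∈V_ (p : ℕ) : Formula → Set where
  atm : p ∈V atom p
  ∧l  : ∀ {A B} → p ∈V A → p ∈V (A ∧ᶠ B)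
  ∧r  : ∀ {A B} → p ∈V B → p ∈V (A ∧ᶠ B)
  ∨l  : ∀ {A B} → p ∈V A → p ∈V (A ∨ᶠ B)
  ∨r  : ∀ {A B} → p ∈V B → p ∈V (A ∨ᶠ B)
  ¬i  : ∀ {A} → p ∈V A → p ∈V (¬ᶠ A)

Interpolant : Formula → Formula → Formula → Set
Interpolant A B C =
  (∀ p → p ∈V C → (p ∈V A) × (p ∈V B)) × Valid (A ⇒ᶠ C) × Valid (C ⇒ᶠ B)

-- A split sequent Γ₁;Γ₂ ⇒ Δ₁;Δ₂ is represented by two
-- lists of side-tagged formulas (antecedent, succedent); formulas tagged
-- `left` form Γ₁,Δ₁ and those tagged `right` form Γ₂,Δ₂.  Lists are taken
-- modulo permutation (exchange rule) so that they represent multisets.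

data Side : Set where
  left right : Side

SFormula : Set
SFormula = Side × Formula

OnSide : Side → List SFormula → List SFormula → ℕ → Set
OnSide s Γ Δ p = Any (λ { (t , F) → (t ≡ s) × (p ∈V F) }) (Γ ++ Δ)

data AtCut : Formula → Set where
  cut-atom : ∀ p → AtCut (atom p)
  cut-⊥    : AtCut ⊥ᶠ
  cut-⊤    : AtCut ⊤ᶠ

infix 3 _⊢_

data _⊢_ : List SFormula → List SFormula → Set where
  ax    : ∀ s t p → ((s , atom p) ∷ []) ⊢ ((t , atom p) ∷ [])
  ax⊥   : ∀ s → ((s , ⊥ᶠ) ∷ []) ⊢ []
  perm  : ∀ {Γ Γ' Δ Δ'} → Γ ↭ Γ' → Δ ↭ Δ' → Γ ⊢ Δ → Γ' ⊢ Δ'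
  wL    : ∀ {Γ Δ} s A → Γ ⊢ Δ → ((s , A) ∷ Γ) ⊢ Δ
  wR    : ∀ {Γ Δ} s A → Γ ⊢ Δ → Γ ⊢ ((s , A) ∷ Δ)
  cL    : ∀ {Γ Δ} s A → ((s , A) ∷ (s , A) ∷ Γ) ⊢ Δ → ((s , A) ∷ Γ) ⊢ Δ
  cR    : ∀ {Γ Δ} s A → Γ ⊢ ((s , A) ∷ (s , A) ∷ Δ) → Γ ⊢ ((s , A) ∷ Δ)
  L∧₁   : ∀ {Γ Δ} s A B → ((s , A) ∷ Γ) ⊢ Δ → ((s , A ∧ᶠ B) ∷ Γ) ⊢ Δ
  L∧₂   : ∀ {Γ Δ} s A B → ((s , B) ∷ Γ) ⊢ Δ → ((s , A ∧ᶠ B) ∷ Γ) ⊢ Δ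
  R∧    : ∀ {Γ Δ} s A B → Γ ⊢ ((s , A) ∷ Δ) → Γ ⊢ ((s , B) ∷ Δ)
                        → Γ ⊢ ((s , A ∧ᶠ B) ∷ Δ)
  R∨₁   : ∀ {Γ Δ} s A B → Γ ⊢ ((s , A) ∷ Δ) → Γ ⊢ ((s , A ∨ᶠ B) ∷ Δ)
  R∨₂   : ∀ {Γ Δ} s A B → Γ ⊢ ((s , B) ∷ Δ) → Γ ⊢ ((s , A ∨ᶠ B) ∷ Δ)
  L∨    : ∀ {Γ Δ} s A B → ((s , A) ∷ Γ) ⊢ Δ → ((s , B) ∷ Γ) ⊢ Δ
                        → ((s , A ∨ᶠ B) ∷ Γ) ⊢ Δ
  L¬    : ∀ {Γ Δ} s A → Γ ⊢ ((s , A) ∷ Δ) → ((s , ¬ᶠ A) ∷ Γ) ⊢ Δ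
  R¬    : ∀ {Γ Δ} s A → ((s , A) ∷ Γ) ⊢ Δ → Γ ⊢ ((s , ¬ᶠ A) ∷ Δ)
  cut   : ∀ {Γ Δ} s A → AtCut A → (∀ p → p ∈V A → OnSide s Γ Δ p)
        → Γ ⊢ ((s , A) ∷ Δ) → ((s , A) ∷ Γ) ⊢ Δ → Γ ⊢ Δ

axI : Side → Side → ℕ → Formula
axI left  left  p = ⊥ᶠ
axI right right p = ⊤ᶠ
axI left  right p = atom p
axI right left  p = ¬ᶠ (atom p)

ax⊥I : Side → Formula
ax⊥I left  = ⊥ᶠ
ax⊥I right = ⊤ᶠ

bin : Side → Formula → Formula → Formula
bin left  C D = C ∨ᶠ D
bin right C D = C ∧ᶠ D

M : ∀ {Γ Δ} → Γ ⊢ Δ → Formula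
M (ax s t p)          = axI s t p
M (ax⊥ s)             = ax⊥I s
M (perm _ _ π)        = M π
M (wL _ _ π)          = M π
M (wR _ _ π)          = M π
M (cL _ _ π)          = M π
M (cR _ _ π)          = M π
M (L∧₁ _ _ _ π)       = M π
M (L∧₂ _ _ _ π)       = M π
M (R∧ s _ _ π₁ π₂)    = bin s (M π₁) (M π₂)
M (R∨₁ _ _ _ π)       = M π
M (R∨₂ _ _ _ π)       = M π
M (L∨ s _ _ π₁ π₂)    = bin s (M π₁) (M π₂)
M (L¬ _ _ π)          = M π
M (R¬ _ _ π)          = M π
M (cut s _ _ _ π₁ π₂) = bin s (M π₁) (M π₂)

-- Cut on every atom of A and B in turn.  For an atom p shared by A and B, a right cut on p whose
-- premises are left cuts on p closed by the axioms p;⇒;p and ;p⇒p; has Maehara interpolant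
-- (M₀ ∨ p) ∧ (¬p ∨ M₁), i.e. "if p then M₁ else M₀": a Shannon expansion step.  For an atom
-- private to A (resp. B) a left (resp. right) cut gives M₀ ∨ M₁ (resp. M₀ ∧ M₁), which is C again
-- since C does not mention that atom.  Once every atom is fixed by a valuation u and recorded as a
-- literal in the sequent, either C(u) is false, hence A(u) is false and A;⇒ is derivable on the
-- left side with interpolant ⊥, or C(u) is true, hence B(u) is true and ⇒;B is derivable on the
-- right side with interpolant ⊤.  The resulting proof therefore computes the Shannon expansion of C.

module Submission where

open import Defs
open import Data.List using (List; []; _∷_)
open import Data.Product using (Σ; _,_)

open import Data.Bool using (Bool; true; false; _∧_; _∨_; not; if_then_else_)
open import Data.Bool.Properties using (∨-idem; ∧-idem; ∨-zeroʳ; ∨-identityʳ; ∧-identityʳ)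
open import Data.Empty using (⊥-elim)
open import Data.List using (_++_)
open import Data.List.Membership.Propositional using (_∈_)
open import Data.List.Membership.Propositional.Properties using (∈-∃++; ∈-++⁺ˡ; ∈-++⁺ʳ)
open import Data.List.Relation.Binary.Permutation.Propositional using (_↭_; ↭-refl; ↭-sym; prep)
open import Data.List.Relation.Binary.Permutation.Propositional.Properties using (++-comm; shift)
open import Data.List.Relation.Binary.Subset.Propositional using (_⊆_)
open import Data.List.Relation.Unary.Any using (here; there)
import Data.List.Relation.Unary.Any as Any
open import Data.Nat using (ℕ; _≟_)
open import Data.Product using (_×_; ∃; map; proj₁; proj₂)
open import Data.Sum using (_⊎_; inj₁; inj₂; [_,_])
open import Function using (id; _∘_)
open import Relation.Binary.PropositionalEquality using (_≡_; _≢_; refl; sym; trans; cong; cong₂; subst)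
open import Relation.Nullary using (Dec; yes; no; ¬_)
open import Relation.Nullary.Decidable using (map′; _⊎-dec_)

focus : ∀ {A : Set} {x : A} {xs} → x ∈ xs → ∃ λ rest → xs ↭ x ∷ rest
focus x∈xs with ys , zs , refl ← ∈-∃++ x∈xs = ys ++ zs , shift _ ys zs

infix 3 _⊢⟦_⟧_

_⊢⟦_⟧_ : List SFormula → (Valuation → Bool) → List SFormula → Set
Γ ⊢⟦ f ⟧ Δ = Σ (Γ ⊢ Δ) (λ π → ∀ w → eval w (M π) ≡ f w)

module _ {f : Valuation → Bool} where

  resp : ∀ {Γ Δ g} → (∀ w → f w ≡ g w) → Γ ⊢⟦ f ⟧ Δ → Γ ⊢⟦ g ⟧ Δ
  resp f≗g = map id (λ e w → trans (e w) (f≗g w))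

  permute : ∀ {Γ Γ' Δ Δ'} → Γ ↭ Γ' → Δ ↭ Δ' → Γ ⊢⟦ f ⟧ Δ → Γ' ⊢⟦ f ⟧ Δ'
  permute ρ σ = map (perm ρ σ) id

  weakenL : ∀ {Γ Δ} Γ' → Γ ⊢⟦ f ⟧ Δ → Γ' ++ Γ ⊢⟦ f ⟧ Δ
  weakenL []             P = P
  weakenL ((s , A) ∷ Γ') P = map (wL s A) id (weakenL Γ' P)

  weakenR : ∀ {Γ Δ} Δ' → Γ ⊢⟦ f ⟧ Δ → Γ ⊢⟦ f ⟧ Δ' ++ Δ
  weakenR []             P = P
  weakenR ((s , A) ∷ Δ') P = map (wR s A) id (weakenR Δ' P)

  widen : ∀ {Γ Δ} Γ' Δ' → Γ ⊢⟦ f ⟧ Δ → Γ ++ Γ' ⊢⟦ f ⟧ Δ ++ Δ'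
  widen {Γ} {Δ} Γ' Δ' P = permute (++-comm Γ' Γ) (++-comm Δ' Δ) (weakenL Γ' (weakenR Δ' P))

  contractL : ∀ {Γ Δ s A} → (s , A) ∈ Γ → (s , A) ∷ Γ ⊢⟦ f ⟧ Δ → Γ ⊢⟦ f ⟧ Δ
  contractL {s = s} {A} x∈Γ P with rest , ρ ← focus x∈Γ =
    permute (↭-sym ρ) ↭-refl (map (cL s A) id (permute (prep _ ρ) ↭-refl P))

  contractR : ∀ {Γ Δ s A} → (s , A) ∈ Δ → Γ ⊢⟦ f ⟧ (s , A) ∷ Δ → Γ ⊢⟦ f ⟧ Δ
  contractR {s = s} {A} x∈Δ P with rest , ρ ← focus x∈Δ =
    permute ↭-refl (↭-sym ρ) (map (cR s A) id (permute ↭-refl (prep _ ρ) P))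

join : Side → Bool → Bool → Bool
join left  = _∨_
join right = _∧_

join-idem : ∀ s b → join s b b ≡ b
join-idem left  = ∨-idem
join-idem right = ∧-idem

eval-bin : ∀ s {X Y} {f g : Valuation → Bool} → (∀ w → eval w X ≡ f w) → (∀ w → eval w Y ≡ g w)
         → ∀ w → eval w (bin s X Y) ≡ join s (f w) (g w)
eval-bin left  eX eY w = cong₂ _∨_ (eX w) (eY w)
eval-bin right eX eY w = cong₂ _∧_ (eX w) (eY w)

axiom-∈ : ∀ {Γ Δ s t q} → (s , atom q) ∈ Γ → (t , atom q) ∈ Δ → Γ ⊢⟦ (λ w → eval w (axI s t q)) ⟧ Δ
axiom-∈ {s = s} {t} {q} x∈Γ y∈Δ with Γ' , ρ ← focus x∈Γ | Δ' , σ ← focus y∈Δ =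
  permute (↭-sym ρ) (↭-sym σ) (widen Γ' Δ' (ax s t q , λ _ → refl))

ax⊥-head : ∀ {Γ Δ} s → (s , ⊥ᶠ) ∷ Γ ⊢⟦ (λ w → eval w (ax⊥I s)) ⟧ Δ
ax⊥-head {Γ} {Δ} s = widen Γ Δ (ax⊥ s , λ _ → refl)

atom-onSide : ∀ {s F m Γ Δ} → (s , F) ∈ Γ ++ Δ → m ∈V F → ∀ p → p ∈V atom m → OnSide s Γ Δ p
atom-onSide F∈ m∈F _ atm = Any.map (λ { refl → refl , m∈F }) F∈

cut-on-atom : ∀ {Γ Δ s F m f g} → (s , F) ∈ Γ ++ Δ → m ∈V F
            → Γ ⊢⟦ f ⟧ (s , atom m) ∷ Δ → (s , atom m) ∷ Γ ⊢⟦ g ⟧ Δ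
            → Γ ⊢⟦ (λ w → join s (f w) (g w)) ⟧ Δ
cut-on-atom {Γ} {Δ} {s} {m = m} F∈ m∈F (π₁ , e₁) (π₂ , e₂) =
  cut s (atom m) (cut-atom m) (atom-onSide {Γ = Γ} F∈ m∈F) π₁ π₂ , eval-bin s e₁ e₂

cut-redundant : ∀ {Γ Δ s F m f} → (s , F) ∈ Γ ++ Δ → m ∈V F
              → Γ ⊢⟦ f ⟧ (s , atom m) ∷ Δ → (s , atom m) ∷ Γ ⊢⟦ f ⟧ Δ → Γ ⊢⟦ f ⟧ Δ
cut-redundant {Γ} {Δ} {s} F∈ m∈F P Q = resp (λ w → join-idem s _) (cut-on-atom {Γ} {Δ} F∈ m∈F P Q)

split-shared : ∀ {Γ Δ F G m f g} → (left , F) ∈ Γ → m ∈V F → (right , G) ∈ Δ → m ∈V G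
             → Γ ⊢⟦ f ⟧ (left , atom m) ∷ (right , atom m) ∷ Δ
             → (left , atom m) ∷ (right , atom m) ∷ Γ ⊢⟦ g ⟧ Δ
             → Γ ⊢⟦ (λ w → if w m then g w else f w) ⟧ Δ
split-shared {Γ} {m = m} F∈Γ m∈F G∈Δ m∈G P Q =
  resp (λ w → case-split (w m))
    (cut-on-atom (∈-++⁺ʳ Γ G∈Δ) m∈G
      (cut-on-atom (∈-++⁺ˡ F∈Γ) m∈F P (axiom-∈ (here refl) (here refl)))
      (cut-on-atom (∈-++⁺ˡ (there F∈Γ)) m∈F (axiom-∈ (here refl) (here refl)) Q))
  where
  case-split : ∀ {x y} b → (x ∨ b) ∧ (not b ∨ y) ≡ (if b then y else x)
  case-split {x} true  rewrite ∨-zeroʳ x = refl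
  case-split {x} false rewrite ∨-identityʳ x = ∧-identityʳ x

neutral : Side → Bool
neutral left  = false
neutral right = true

eval-ax⊥I : ∀ s w → eval w (ax⊥I s) ≡ neutral s
eval-ax⊥I left  w = refl
eval-ax⊥I right w = refl

eval-axI-self : ∀ s q w → eval w (axI s s q) ≡ neutral s
eval-axI-self left  q w = refl
eval-axI-self right q w = refl

Records : Side → Valuation → List SFormula → List SFormula → ℕ → Set
Records s u Γ Δ q = if u q then (s , atom q) ∈ Γ else (s , atom q) ∈ Δ

Settles : Side → Bool → Formula → List SFormula → List SFormula → Set
Settles s true  F Γ Δ = Γ ⊢⟦ (λ _ → neutral s) ⟧ (s , F) ∷ Δ
Settles s false F Γ Δ = (s , F) ∷ Γ ⊢⟦ (λ _ → neutral s) ⟧ Δ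

module _ (s : Side) (u : Valuation) (Γ Δ : List SFormula) where

  settle : ∀ F → (∀ q → q ∈V F → Records s u Γ Δ q) → Settles s (eval u F) F Γ Δ
  settle (atom q) rec with u q | rec q atm
  ... | true  | q∈Γ = resp (eval-axI-self s q) (axiom-∈ q∈Γ (here refl))
  ... | false | q∈Δ = resp (eval-axI-self s q) (axiom-∈ (here refl) q∈Δ)
  settle ⊥ᶠ rec = resp (eval-ax⊥I s) (ax⊥-head s)
  settle (F ∧ᶠ G) rec with eval u F | settle F (λ q → rec q ∘ ∧l) | eval u G | settle G (λ q → rec q ∘ ∧r)
  ... | true  | (πF , eF) | true  | (πG , eG) = resp (λ _ → join-idem s _) (R∧ s F G πF πG , eval-bin s eF eG)
  ... | false | PF        | _     | _         = map (L∧₁ s F G) id PF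
  ... | true  | _         | false | PG        = map (L∧₂ s F G) id PG
  settle (F ∨ᶠ G) rec with eval u F | settle F (λ q → rec q ∘ ∨l) | eval u G | settle G (λ q → rec q ∘ ∨r)
  ... | false | (πF , eF) | false | (πG , eG) = resp (λ _ → join-idem s _) (L∨ s F G πF πG , eval-bin s eF eG)
  ... | true  | PF        | _     | _         = map (R∨₁ s F G) id PF
  ... | false | _         | true  | PG        = map (R∨₂ s F G) id PG
  settle (¬ᶠ F) rec with eval u F | settle F (λ q → rec q ∘ ¬i)
  ... | true  | PF = map (L¬ s F) id PF
  ... | false | PF = map (R¬ s F) id PF

eval-cong : ∀ F {v v' : Valuation} → (∀ q → q ∈V F → v q ≡ v' q) → eval v F ≡ eval v' F
eval-cong (atom p) eq = eq p atm
eval-cong ⊥ᶠ       eq = refl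
eval-cong (F ∧ᶠ G) eq = cong₂ _∧_ (eval-cong F (λ q → eq q ∘ ∧l)) (eval-cong G (λ q → eq q ∘ ∧r))
eval-cong (F ∨ᶠ G) eq = cong₂ _∨_ (eval-cong F (λ q → eq q ∘ ∨l)) (eval-cong G (λ q → eq q ∘ ∨r))
eval-cong (¬ᶠ F)   eq = cong not (eval-cong F (λ q → eq q ∘ ¬i))

_[_↦_] : Valuation → ℕ → Bool → Valuation
(u [ m ↦ b ]) q with q ≟ m
... | yes _ = b
... | no  _ = u q

update-≡ : ∀ u m b → (u [ m ↦ b ]) m ≡ b
update-≡ u m b with m ≟ m
... | yes _   = refl
... | no  m≢m = ⊥-elim (m≢m refl)

update-≢ : ∀ u {m q} b → q ≢ m → (u [ m ↦ b ]) q ≡ u q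
update-≢ u {m} {q} b q≢m with q ≟ m
... | yes q≡m = ⊥-elim (q≢m q≡m)
... | no  _   = refl

update-cong : ∀ {u u' : Valuation} m b q → u q ≡ u' q → (u [ m ↦ b ]) q ≡ (u' [ m ↦ b ]) q
update-cong m b q eq with q ≟ m
... | yes _ = refl
... | no  _ = eq

patch : List ℕ → Valuation → Valuation → Valuation
patch []       w u = u
patch (m ∷ ms) w u = patch ms w (u [ m ↦ w m ])

patch-cong : ∀ ms w {u u' : Valuation} q → u q ≡ u' q → patch ms w u q ≡ patch ms w u' q
patch-cong []       w q eq = eq
patch-cong (m ∷ ms) w q eq = patch-cong ms w q (update-cong m (w m) q eq)

patch-self : ∀ ms w q → patch ms w w q ≡ w q
patch-self []       w q = refl
patch-self (m ∷ ms) w q = trans (patch-cong ms w q self) (patch-self ms w q)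
  where
  self : (w [ m ↦ w m ]) q ≡ w q
  self with q ≟ m
  ... | yes refl = refl
  ... | no  _    = refl

patch-∈ : ∀ {ms} w u {q} → q ∈ ms → patch ms w u q ≡ w q
patch-∈ {m ∷ ms} w u (here refl) = trans (patch-cong ms w m (update-≡ u m (w m))) (patch-self ms w m)
patch-∈ {m ∷ ms} w u (there q∈ms) = patch-∈ w (u [ m ↦ w m ]) q∈ms

atoms : Formula → List ℕ
atoms (atom p) = p ∷ []
atoms ⊥ᶠ       = []
atoms (F ∧ᶠ G) = atoms F ++ atoms G
atoms (F ∨ᶠ G) = atoms F ++ atoms G
atoms (¬ᶠ F)   = atoms F

∈V⇒∈atoms : ∀ {p F} → p ∈V F → p ∈ atoms F
∈V⇒∈atoms atm    = here refl
∈V⇒∈atoms (∧l x) = ∈-++⁺ˡ (∈V⇒∈atoms x)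
∈V⇒∈atoms {F = F ∧ᶠ _} (∧r x) = ∈-++⁺ʳ (atoms F) (∈V⇒∈atoms x)
∈V⇒∈atoms (∨l x) = ∈-++⁺ˡ (∈V⇒∈atoms x)
∈V⇒∈atoms {F = F ∨ᶠ _} (∨r x) = ∈-++⁺ʳ (atoms F) (∈V⇒∈atoms x)
∈V⇒∈atoms (¬i x) = ∈V⇒∈atoms x

_∈V?_ : ∀ p F → Dec (p ∈V F)
p ∈V? atom q   = map′ (λ { refl → atm }) (λ { atm → refl }) (p ≟ q)
p ∈V? ⊥ᶠ       = no λ ()
p ∈V? (F ∧ᶠ G) = map′ [ ∧l , ∧r ] (λ { (∧l x) → inj₁ x ; (∧r x) → inj₂ x }) (p ∈V? F ⊎-dec p ∈V? G)
p ∈V? (F ∨ᶠ G) = map′ [ ∨l , ∨r ] (λ { (∨l x) → inj₁ x ; (∨r x) → inj₂ x }) (p ∈V? F ⊎-dec p ∈V? G)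
p ∈V? (¬ᶠ F)   = map′ ¬i (λ { (¬i x) → x }) (p ∈V? F)

module _ {s : Side} {Γ Δ : List SFormula} where

  records-mono : ∀ {u Γ' Δ' q} → Γ ⊆ Γ' → Δ ⊆ Δ' → Records s u Γ Δ q → Records s u Γ' Δ' q
  records-mono {u} {q = q} Γ⊆Γ' Δ⊆Δ' r with u q
  ... | true  = Γ⊆Γ' r
  ... | false = Δ⊆Δ' r

  records-update-≡ : ∀ u m b → (if b then (s , atom m) ∈ Γ else (s , atom m) ∈ Δ)
                   → Records s (u [ m ↦ b ]) Γ Δ m
  records-update-≡ u m b r rewrite update-≡ u m b = r

  records-update-≢ : ∀ u {m q} b → q ≢ m → Records s u Γ Δ q → Records s (u [ m ↦ b ]) Γ Δ q
  records-update-≢ u b q≢m r rewrite update-≢ u b q≢m = r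

Covered : Side → List ℕ → Valuation → List SFormula → List SFormula → Formula → Set
Covered s ps u Γ Δ F = ∀ q → q ∈V F → q ∈ ps ⊎ Records s u Γ Δ q

module _ {s : Side} {u : Valuation} {Γ Δ : List SFormula} {F : Formula} where

  covered-[] : Covered s [] u Γ Δ F → ∀ q → q ∈V F → Records s u Γ Δ q
  covered-[] cov q q∈F with cov q q∈F
  ... | inj₂ r = r

  covered-step : ∀ {m ps b Γ' Δ'} → Covered s (m ∷ ps) u Γ Δ F → Γ ⊆ Γ' → Δ ⊆ Δ'
               → (m ∈V F → Records s (u [ m ↦ b ]) Γ' Δ' m) → Covered s ps (u [ m ↦ b ]) Γ' Δ' F
  covered-step {m} cov Γ⊆Γ' Δ⊆Δ' new q q∈F with cov q q∈F
  ... | inj₁ (here refl)   = inj₂ (new q∈F)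
  ... | inj₁ (there q∈ps)  = inj₁ q∈ps
  -- deciding m ≟ q rather than q ≟ m keeps the goal's (u [ m ↦ b ]) q from being abstracted
  ... | inj₂ r with m ≟ q
  ...   | yes refl = inj₂ (new q∈F)
  ...   | no  m≢q  = inj₂ (records-update-≢ u _ (m≢q ∘ sym) (records-mono {u = u} Γ⊆Γ' Δ⊆Δ' r))

antecedent-false : ∀ {a c} → not a ∨ c ≡ true → c ≡ false → a ≡ false
antecedent-false {false} _    _  = refl
antecedent-false {true}  refl ()

consequent-true : ∀ {c b} → not c ∨ b ≡ true → c ≡ true → b ≡ true
consequent-true {true}  b≡true _  = b≡true
consequent-true {false} _      ()

module Interpolation (A B C : Formula) (C-atoms : ∀ p → p ∈V C → p ∈V A × p ∈V B)
                     (A⇒C : Valid (A ⇒ᶠ C)) (C⇒B : Valid (C ⇒ᶠ B)) where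

  record Frame (ps : List ℕ) (u : Valuation) (Γ Δ : List SFormula) : Set where
    field
      A∈Γ       : (left , A) ∈ Γ
      B∈Δ       : (right , B) ∈ Δ
      A-covered : Covered left ps u Γ Δ A
      B-covered : Covered right ps u Γ Δ B

  open Frame

  frame-step : ∀ {m ps u Γ Δ Γ' Δ'} b → Frame (m ∷ ps) u Γ Δ → Γ ⊆ Γ' → Δ ⊆ Δ'
             → (m ∈V A → Records left (u [ m ↦ b ]) Γ' Δ' m)
             → (m ∈V B → Records right (u [ m ↦ b ]) Γ' Δ' m)
             → Frame ps (u [ m ↦ b ]) Γ' Δ'
  frame-step b fr Γ⊆Γ' Δ⊆Δ' newA newB = record
    { A∈Γ       = Γ⊆Γ' (A∈Γ fr)
    ; B∈Δ       = Δ⊆Δ' (B∈Δ fr)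
    ; A-covered = covered-step (A-covered fr) Γ⊆Γ' Δ⊆Δ' newA
    ; B-covered = covered-step (B-covered fr) Γ⊆Γ' Δ⊆Δ' newB
    }

  -- C with the atoms outside ps frozen to their values under u
  frozen : List ℕ → Valuation → Valuation → Bool
  frozen ps u w = eval (patch ps w u) C

  frozen-split : ∀ m ps u w → frozen (m ∷ ps) u w
               ≡ (if w m then frozen ps (u [ m ↦ true ]) w else frozen ps (u [ m ↦ false ]) w)
  frozen-split m ps u w with w m
  ... | true  = refl
  ... | false = refl

  frozen-irrelevant : ∀ {m} ps u b → ¬ m ∈V C → ∀ w → frozen ps (u [ m ↦ b ]) w ≡ frozen (m ∷ ps) u w
  frozen-irrelevant {m} ps u b m∉C w = eval-cong C λ q q∈C →
    patch-cong ps w q (trans (update-≢ u b (q≢m q∈C)) (sym (update-≢ u (w m) (q≢m q∈C))))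
    where
    q≢m : ∀ {q} → q ∈V C → q ≢ m
    q≢m q∈C refl = m∉C q∈C

  decided : ∀ u {Γ Δ} → Frame [] u Γ Δ → Γ ⊢⟦ (λ _ → eval u C) ⟧ Δ
  decided u {Γ} {Δ} fr with eval u C in C≡
  ... | false = contractL (A∈Γ fr)
    (subst (λ b → Settles left b A Γ Δ) (antecedent-false (A⇒C u) C≡)
      (settle left u Γ Δ A (covered-[] (A-covered fr))))
  ... | true = contractR (B∈Δ fr)
    (subst (λ b → Settles right b B Γ Δ) (consequent-true (C⇒B u) C≡)
      (settle right u Γ Δ B (covered-[] (B-covered fr))))

  interpolate : ∀ ps u {Γ Δ} → Frame ps u Γ Δ → Γ ⊢⟦ frozen ps u ⟧ Δ
  interpolate []       u fr = decided u fr
  interpolate (m ∷ ps) u {Γ} fr with m ∈V? A | m ∈V? B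
  ... | yes m∈A | yes m∈B =
    resp (λ w → sym (frozen-split m ps u w)) (split-shared (A∈Γ fr) m∈A (B∈Δ fr) m∈B
      (interpolate ps _ (frame-step false fr id (there ∘ there)
        (λ _ → records-update-≡ u m false (here refl)) (λ _ → records-update-≡ u m false (there (here refl)))))
      (interpolate ps _ (frame-step true fr (there ∘ there) id
        (λ _ → records-update-≡ u m true (here refl)) (λ _ → records-update-≡ u m true (there (here refl))))))
  ... | yes m∈A | no m∉B =
    cut-redundant (∈-++⁺ˡ (A∈Γ fr)) m∈A
      (resp (frozen-irrelevant ps u false m∉C) (interpolate ps _ (frame-step false fr id there
        (λ _ → records-update-≡ u m false (here refl)) (⊥-elim ∘ m∉B))))
      (resp (frozen-irrelevant ps u true m∉C) (interpolate ps _ (frame-step true fr there id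
        (λ _ → records-update-≡ u m true (here refl)) (⊥-elim ∘ m∉B))))
    where
    m∉C : ¬ m ∈V C
    m∉C = m∉B ∘ proj₂ ∘ C-atoms m
  ... | no m∉A | yes m∈B =
    cut-redundant (∈-++⁺ʳ Γ (B∈Δ fr)) m∈B
      (resp (frozen-irrelevant ps u false m∉C) (interpolate ps _ (frame-step false fr id there
        (⊥-elim ∘ m∉A) (λ _ → records-update-≡ u m false (here refl)))))
      (resp (frozen-irrelevant ps u true m∉C) (interpolate ps _ (frame-step true fr there id
        (⊥-elim ∘ m∉A) (λ _ → records-update-≡ u m true (here refl)))))
    where
    m∉C : ¬ m ∈V C
    m∉C = m∉A ∘ proj₁ ∘ C-atoms m
  ... | no m∉A | no m∉B =
    resp (frozen-irrelevant ps u false m∉C) (interpolate ps _ (frame-step false fr id id (⊥-elim ∘ m∉A) (⊥-elim ∘ m∉B)))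
    where
    m∉C : ¬ m ∈V C
    m∉C = m∉A ∘ proj₁ ∘ C-atoms m

theorem6p1 : ∀ (A B C : Formula) → Valid (A ⇒ᶠ B) → Interpolant A B C
    → Σ (((left , A) ∷ []) ⊢ ((right , B) ∷ [])) (λ π → M π ≈ᶠ C)
-- validity of A → B is implied by the existence of the interpolant
theorem6p1 A B C _ (C-atoms , A⇒C , C⇒B) =
  resp frozen-all (interpolate ps (λ _ → false) record
    { A∈Γ       = here refl
    ; B∈Δ       = here refl
    ; A-covered = λ q q∈A → inj₁ (∈-++⁺ˡ (∈V⇒∈atoms q∈A))
    ; B-covered = λ q q∈B → inj₁ (∈-++⁺ʳ (atoms A) (∈V⇒∈atoms q∈B))
    })
  where
  open Interpolation A B C C-atoms A⇒C C⇒B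
  ps : List ℕ
  ps = atoms A ++ atoms B
  frozen-all : ∀ w → frozen ps (λ _ → false) w ≡ eval w C
  frozen-all w = eval-cong C λ q q∈C → patch-∈ w _ (∈-++⁺ˡ (∈V⇒∈atoms (proj₁ (C-atoms q q∈C))))
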